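{- Let $q$ be a prime and $y$ an integer. Then for all integers $n\geq1$, $w_{q+n-1}(y)\equiv w_{n}(y)\pmod{q}$.
   Context: The geometric polynomials are $w_{n}(y)=\sum_{k=0}^{n}\left\{{n\atop k}\right\}k!\,y^{k}$, where $\left\{{n\atop k}\right\}$ are Stirling numbers of the second kind. -}

module Defs where

open import Data.Nat using (ℕ; zero; suc)
import Data.Nat as ℕ
open import Data.Nat using (_!)
open import Data.Integer using (ℤ; +_; _+_; _*_; _^_)

stirling2 : ℕ → ℕ → ℕ
stirling2 zero    zero    = 1
stirling2 zero    (suc k) = 0
stirling2 (suc n) zero    = 0
stirling2 (suc n) (suc k) = suc k ℕ.* stirling2 n (suc k) ℕ.+ stirling2 n k

sumTo : ℕ → (ℕ → ℤ) → ℤ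
sumTo zero    f = f 0
sumTo (suc m) f = sumTo m f + f (suc m)

w : ℕ → ℤ → ℤ
w n y = sumTo n (λ k → + (stirling2 n k ℕ.* (k !)) * (y ^ k))

-- Writing A(n,k) = {n k} k!, one has A(n,k) = (Δᵏ xⁿ)(0) for the forward
-- difference Δf(x) = f(x+1) − f(x). By Fermat's little theorem (obtained from
-- (1+x)^q ≡ 1+x^q, as q divides the inner binomial coefficients)
-- x^(q+n−1) ≡ xⁿ (mod q) for every natural x and n ≥ 1, and Δᵏ preserves
-- pointwise congruences, so A(q+n−1,k) ≡ A(n,k) (mod q) for every k. The two
-- sums defining w_{q+n−1}(y) and w_n(y) then agree modulo q term by term,
-- the extra terms of the longer one vanishing because {n k} = 0 for k > n.
module Submission where

open import Defs
open import Level using (0ℓ)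
open import Data.Nat as ℕ
  using (ℕ; zero; suc; _≥_; _<_; _≤′_; _!; s≤s; z≤n; ≤′-refl; ≤′-step)
open import Data.Nat.Properties as ℕ using (_!*_!≢0)
open import Data.Nat.Divisibility as ℕ using (∣⇒≤; ∣1⇒≡1; m∣m*n)
open import Data.Nat.DivMod using (_/_; m/n*n≡m)
open import Data.Nat.Combinatorics using (_C_; nCk≡n!/k![n-k]!; k![n∸k]!∣n!; nCn≡1)
open import Data.Nat.Primality using (Prime; euclidsLemma; ¬prime[1]; prime⇒nonZero)
import Data.Nat.Tactic.RingSolver as ℕ-Solver
open import Data.Fin.Base using (zero; suc; toℕ; inject₁; fromℕ)
open import Data.Fin.Properties using (toℕ-fromℕ; toℕ-inject₁; toℕ<n)
open import Data.Vec.Functional using (Vector; last; tail)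
open import Data.Integer as ℤ using (ℤ; +_; _+_; _*_; _-_; -_; _^_; 0ℤ; 1ℤ)
open import Data.Integer.Properties as ℤ using (+-*-commutativeSemiring; +-*-semiring; +-0-monoid)
open import Data.Integer.Divisibility using (_∣_)
open import Data.Integer.Divisibility.Signed
  using (divides; ∣ᵤ⇒∣; ∣⇒∣ᵤ; ∣m∣n⇒∣m+n; ∣m∣n⇒∣m-n; ∣m⇒∣m*n; ∣n⇒∣m*n; ∣m⇒∣-m)
  renaming (_∣_ to _∣ˢ_)
open import Data.Integer.Tactic.RingSolver using (solve-∀)
open import Algebra.Properties.Monoid.Sum +-0-monoid using (sum)
import Algebra.Properties.CommutativeSemiring.Binomial +-*-commutativeSemiring as Binomial
open import Algebra.Properties.Semiring.Exp +-*-semiring using () renaming (_^_ to _^ᴹ_)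
open import Algebra.Properties.Semiring.Mult +-*-semiring using () renaming (_×_ to _×ᴹ_)
open import Data.Sum using (inj₁; inj₂)
open import Function.Base using (_∘_)
open import Relation.Nullary using (¬_; contradiction)
open import Relation.Binary.Bundles using (Setoid)
open import Relation.Binary.Structures using (IsEquivalence)
open import Relation.Binary.PropositionalEquality
  using (_≡_; refl; sym; trans; subst; cong; cong₂; module ≡-Reasoning)
import Relation.Binary.Reasoning.Setoid as SetoidReasoning

infix 4 _≡_mod_
record _≡_mod_ (a b m : ℤ) : Set where
  constructor ∣⇒≡-mod
  field ≡-mod⇒∣ : m ∣ˢ a - b
open _≡_mod_ public

module _ {m : ℤ} where

  ≡⇒≡-mod : ∀ {a b} → a ≡ b → a ≡ b mod m
  ≡⇒≡-mod {a} refl = ∣⇒≡-mod (subst (m ∣ˢ_) (sym (ℤ.+-inverseʳ a)) (divides 0ℤ refl))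

  ≡-mod-refl : ∀ {a} → a ≡ a mod m
  ≡-mod-refl = ≡⇒≡-mod refl

  ∣⇒≡0-mod : ∀ {a} → m ∣ˢ a → a ≡ 0ℤ mod m
  ∣⇒≡0-mod {a} = ∣⇒≡-mod ∘ subst (m ∣ˢ_) (sym (ℤ.+-identityʳ a))

  ≡-mod-sym : ∀ {a b} → a ≡ b mod m → b ≡ a mod m
  ≡-mod-sym {a} {b} (∣⇒≡-mod p) = ∣⇒≡-mod (subst (m ∣ˢ_) (negate a b) (∣m⇒∣-m p))
    where
    negate : ∀ a b → - (a - b) ≡ b - a
    negate = solve-∀

  ≡-mod-trans : ∀ {a b c} → a ≡ b mod m → b ≡ c mod m → a ≡ c mod m
  ≡-mod-trans {a} {b} {c} (∣⇒≡-mod p) (∣⇒≡-mod q) =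
    ∣⇒≡-mod (subst (m ∣ˢ_) (ℤ.+-minus-telescope a b c) (∣m∣n⇒∣m+n p q))

  +-cong-mod : ∀ {a b c d} → a ≡ b mod m → c ≡ d mod m → a + c ≡ b + d mod m
  +-cong-mod {a} {b} {c} {d} (∣⇒≡-mod p) (∣⇒≡-mod q) =
    ∣⇒≡-mod (subst (m ∣ˢ_) (regroup a b c d) (∣m∣n⇒∣m+n p q))
    where
    regroup : ∀ a b c d → (a - b) + (c - d) ≡ (a + c) - (b + d)
    regroup = solve-∀

  minus-cong-mod : ∀ {a b c d} → a ≡ b mod m → c ≡ d mod m → a - c ≡ b - d mod m
  minus-cong-mod {a} {b} {c} {d} (∣⇒≡-mod p) (∣⇒≡-mod q) =
    ∣⇒≡-mod (subst (m ∣ˢ_) (regroup a b c d) (∣m∣n⇒∣m-n p q))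
    where
    regroup : ∀ a b c d → (a - b) - (c - d) ≡ (a - c) - (b - d)
    regroup = solve-∀

  *-cong-mod : ∀ {a b c d} → a ≡ b mod m → c ≡ d mod m → a * c ≡ b * d mod m
  *-cong-mod {a} {b} {c} {d} (∣⇒≡-mod p) (∣⇒≡-mod q) =
    ∣⇒≡-mod (subst (m ∣ˢ_) (regroup a b c d) (∣m∣n⇒∣m+n (∣n⇒∣m*n a q) (∣n⇒∣m*n d p)))
    where
    regroup : ∀ a b c d → a * (c - d) + d * (a - b) ≡ a * c - b * d
    regroup = solve-∀

  ≡-mod-isEquivalence : IsEquivalence (_≡_mod m)
  ≡-mod-isEquivalence = record
    { refl  = ≡-mod-refl
    ; sym   = ≡-mod-sym
    ; trans = ≡-mod-trans
    }

≡-mod-setoid : ℤ → Setoid 0ℓ 0ℓ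
≡-mod-setoid m = record { isEquivalence = ≡-mod-isEquivalence {m} }

n∣n! : ∀ {n} → .{{ℕ.NonZero n}} → n ℕ.∣ n !
n∣n! {suc n} = m∣m*n (n !)

C*k![n∸k]!≡n! : ∀ {n k} → k ℕ.≤ n → (n C k) ℕ.* (k ! ℕ.* (n ℕ.∸ k) !) ≡ n !
C*k![n∸k]!≡n! {n} {k} k≤n = begin
  (n C k) ℕ.* (k ! ℕ.* (n ℕ.∸ k) !)                     ≡⟨ cong (ℕ._* (k ! ℕ.* (n ℕ.∸ k) !)) (nCk≡n!/k![n-k]! k≤n) ⟩
  n ! / (k ! ℕ.* (n ℕ.∸ k) !) ℕ.* (k ! ℕ.* (n ℕ.∸ k) !) ≡⟨ m/n*n≡m (k![n∸k]!∣n! k≤n) ⟩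
  n !                                                   ∎
  where
  open ≡-Reasoning
  instance _ = k !* (n ℕ.∸ k) !≢0

module _ {p : ℕ} (p-prime : Prime p) where

  private instance
    p-nonZero = prime⇒nonZero p-prime

  prime∤! : ∀ {n} → n < p → ¬ (p ℕ.∣ n !)
  prime∤! {zero}  _   p∣1 = ¬prime[1] (subst Prime (∣1⇒≡1 p∣1) p-prime)
  prime∤! {suc n} n<p p∣n! with euclidsLemma (suc n) (n !) p-prime p∣n!
  ... | inj₁ p∣1+n = ℕ.<⇒≱ n<p (∣⇒≤ p∣1+n)
  ... | inj₂ p∣n!  = prime∤! (ℕ.<-trans (ℕ.n<1+n n) n<p) p∣n!

  prime∣C : ∀ {k} → 0 < k → k < p → p ℕ.∣ p C k
  prime∣C {k} 0<k k<p
    with euclidsLemma (p C k) _ p-prime (subst (p ℕ.∣_) (sym (C*k![n∸k]!≡n! (ℕ.<⇒≤ k<p))) n∣n!)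
  ... | inj₁ p∣C = p∣C
  ... | inj₂ p∣k!*[p∸k]! with euclidsLemma (k !) _ p-prime p∣k!*[p∸k]!
  ...   | inj₁ p∣k!     = contradiction p∣k! (prime∤! k<p)
  ...   | inj₂ p∣[p∸k]! = contradiction p∣[p∸k]! (prime∤! (ℕ.∸-monoʳ-< 0<k (ℕ.<⇒≤ k<p)))

sum≡last-mod : ∀ {m n} (t : Vector ℤ (suc n)) → (∀ i → m ∣ˢ t (inject₁ i)) → sum t ≡ last t mod m
sum≡last-mod {n = zero}  t _ = ≡⇒≡-mod (ℤ.+-identityʳ (t zero))
sum≡last-mod {m} {suc n} t middle = begin
  t zero + sum (tail t) ≈⟨ +-cong-mod (∣⇒≡0-mod (middle zero)) (sum≡last-mod (tail t) (middle ∘ suc)) ⟩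
  0ℤ + last t           ≡⟨ ℤ.+-identityˡ (last t) ⟩
  last t                ∎
  where open SetoidReasoning (≡-mod-setoid m)

^ᴹ≡^ : ∀ x n → x ^ᴹ n ≡ x ^ n
^ᴹ≡^ x zero    = refl
^ᴹ≡^ x (suc n) = cong (x *_) (^ᴹ≡^ x n)

×ᴹ≡* : ∀ n x → n ×ᴹ x ≡ + n * x
×ᴹ≡* zero    x = refl
×ᴹ≡* (suc n) x = trans (cong (_+_ x) (×ᴹ≡* n x)) (sym (ℤ.suc-* (+ n) x))

[1+x]^p≡1+x^p : ∀ {p} → Prime p → ∀ x → (1ℤ + x) ^ p ≡ 1ℤ + x ^ p mod + p
[1+x]^p≡1+x^p {suc r} p-prime x = begin
  (1ℤ + x) ^ p          ≡⟨ sym (^ᴹ≡^ (1ℤ + x) p) ⟩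
  (1ℤ + x) ^ᴹ p         ≡⟨ Binomial.theorem p 1ℤ x ⟩
  t zero + sum (tail t) ≈⟨ +-cong-mod (≡-mod-refl {a = t zero}) (sum≡last-mod (tail t) middle) ⟩
  t zero + t (fromℕ p)  ≡⟨ cong₂ _+_ (t≡term zero) (trans (t≡term (fromℕ p)) (cong term (toℕ-fromℕ p))) ⟩
  term 0 + term p       ≡⟨ cong₂ _+_ term[0]≡x^p term[p]≡1 ⟩
  x ^ p + 1ℤ            ≡⟨ ℤ.+-comm (x ^ p) 1ℤ ⟩
  1ℤ + x ^ p            ∎
  where
  open SetoidReasoning (≡-mod-setoid (+ suc r))
  p = suc r
  t = Binomial.binomialTerm 1ℤ x p

  term : ℕ → ℤ
  term k = + (p C k) * (1ℤ ^ k * x ^ (p ℕ.∸ k))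

  t≡term : ∀ i → t i ≡ term (toℕ i)
  t≡term i = trans (×ᴹ≡* (p C toℕ i) (Binomial.binomial 1ℤ x p i))
                   (cong (+ (p C toℕ i) *_) (cong₂ _*_ (^ᴹ≡^ 1ℤ (toℕ i)) (^ᴹ≡^ x (p ℕ.∸ toℕ i))))

  term[0]≡x^p : term 0 ≡ x ^ p
  term[0]≡x^p = trans (ℤ.*-identityˡ _) (ℤ.*-identityˡ _)

  term[p]≡1 : term p ≡ 1ℤ
  term[p]≡1 rewrite nCn≡1 p | ℤ.^-zeroˡ p | ℕ.n∸n≡0 p = refl

  middle : ∀ i → + p ∣ˢ t (suc (inject₁ i))
  middle i rewrite t≡term (suc (inject₁ i)) | toℕ-inject₁ i =
    ∣m⇒∣m*n {m = + (p C suc (toℕ i))} (1ℤ ^ suc (toℕ i) * x ^ (p ℕ.∸ suc (toℕ i)))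
      (∣ᵤ⇒∣ (prime∣C p-prime (s≤s z≤n) (s≤s (toℕ<n i))))

x^p≡x : ∀ {p} → Prime p → ∀ x → (+ x) ^ p ≡ + x mod + p
x^p≡x {suc r} p-prime zero    = ≡⇒≡-mod refl
x^p≡x {suc r} p-prime (suc x) = begin
  (1ℤ + + x) ^ suc r     ≈⟨ [1+x]^p≡1+x^p p-prime (+ x) ⟩
  1ℤ + (+ x) ^ suc r     ≈⟨ +-cong-mod (≡-mod-refl {a = 1ℤ}) (x^p≡x p-prime x) ⟩
  1ℤ + + x               ∎
  where open SetoidReasoning (≡-mod-setoid (+ suc r))

Δ : ℕ → (ℕ → ℤ) → ℕ → ℤ
Δ zero    f x = f x
Δ (suc k) f x = Δ k f (suc x) - Δ k f x

Δ-cong-mod : ∀ {m} k {f g} → (∀ x → f x ≡ g x mod m) → ∀ x → Δ k f x ≡ Δ k g x mod m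
Δ-cong-mod zero    f≡g x = f≡g x
Δ-cong-mod (suc k) f≡g x = minus-cong-mod (Δ-cong-mod k f≡g (suc x)) (Δ-cong-mod k f≡g x)

Δ-const : ∀ k c x → Δ (suc k) (λ _ → c) x ≡ 0ℤ
Δ-const zero    c x = ℤ.+-inverseʳ c
Δ-const (suc k) c x = cong₂ _-_ (Δ-const k c (suc x)) (Δ-const k c x)

Δ[x*f] : ∀ k f x → Δ (suc k) (λ y → + y * f y) x ≡ + x * Δ (suc k) f x + + suc k * Δ k f (suc x)
Δ[x*f] zero    f x = regroup (+ x) (f (suc x)) (f x)
  where
  regroup : ∀ X a b → (1ℤ + X) * a - X * b ≡ X * (a - b) + 1ℤ * a
  regroup = solve-∀
Δ[x*f] (suc k) f x = begin
  Δ (suc k) (λ y → + y * f y) (suc x) - Δ (suc k) (λ y → + y * f y) x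
    ≡⟨ cong₂ _-_ (Δ[x*f] k f (suc x)) (Δ[x*f] k f x) ⟩
  (+ suc x * (a - b) + + suc k * a) - (+ x * (b - c) + + suc k * b)
    ≡⟨ regroup (+ x) (+ k) a b c ⟩
  + x * ((a - b) - (b - c)) + + suc (suc k) * (a - b)
    ∎
  where
  open ≡-Reasoning
  a = Δ k f (suc (suc x))
  b = Δ k f (suc x)
  c = Δ k f x
  regroup : ∀ X K a b c → ((1ℤ + X) * (a - b) + (1ℤ + K) * a) - (X * (b - c) + (1ℤ + K) * b)
                        ≡ X * ((a - b) - (b - c)) + (1ℤ + (1ℤ + K)) * (a - b)
  regroup = solve-∀

stirling2*!-rec : ∀ n k → + (stirling2 (suc n) (suc k) ℕ.* suc k !)
                        ≡ + suc k * (+ (stirling2 n (suc k) ℕ.* suc k !) + + (stirling2 n k ℕ.* k !))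
stirling2*!-rec n k = begin
  + ((suc k ℕ.* s₁ ℕ.+ s₀) ℕ.* (suc k ℕ.* k !))          ≡⟨ cong +_ (regroup k s₁ s₀ (k !)) ⟩
  + (suc k ℕ.* (s₁ ℕ.* suc k ! ℕ.+ s₀ ℕ.* k !))          ≡⟨ ℤ.pos-* (suc k) _ ⟩
  + suc k * + (s₁ ℕ.* suc k ! ℕ.+ s₀ ℕ.* k !)            ≡⟨ cong (+ suc k *_) (ℤ.pos-+ (s₁ ℕ.* suc k !) (s₀ ℕ.* k !)) ⟩
  + suc k * (+ (s₁ ℕ.* suc k !) + + (s₀ ℕ.* k !))        ∎
  where
  open ≡-Reasoning
  s₁ = stirling2 n (suc k)
  s₀ = stirling2 n k
  regroup : ∀ k s₁ s₀ f → (suc k ℕ.* s₁ ℕ.+ s₀) ℕ.* (suc k ℕ.* f)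
                        ≡ suc k ℕ.* (s₁ ℕ.* (suc k ℕ.* f) ℕ.+ s₀ ℕ.* f)
  regroup = ℕ-Solver.solve-∀

stirling2*!≡Δ : ∀ n k → + (stirling2 n k ℕ.* k !) ≡ Δ k (λ x → (+ x) ^ n) 0
stirling2*!≡Δ zero    zero    = refl
stirling2*!≡Δ zero    (suc k) = sym (Δ-const k 1ℤ 0)
stirling2*!≡Δ (suc n) zero    = refl
stirling2*!≡Δ (suc n) (suc k) = begin
  + (stirling2 (suc n) (suc k) ℕ.* suc k !)
    ≡⟨ stirling2*!-rec n k ⟩
  + suc k * (+ (stirling2 n (suc k) ℕ.* suc k !) + + (stirling2 n k ℕ.* k !))
    ≡⟨ cong₂ (λ a b → + suc k * (a + b)) (stirling2*!≡Δ n (suc k)) (stirling2*!≡Δ n k) ⟩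
  + suc k * (Δ (suc k) f 0 + Δ k f 0)
    ≡⟨ cong (+ suc k *_) (cancel (Δ k f 1) (Δ k f 0)) ⟩
  + suc k * Δ k f 1
    ≡⟨ sym (ℤ.+-identityˡ _) ⟩
  + 0 * Δ (suc k) f 0 + + suc k * Δ k f 1
    ≡⟨ sym (Δ[x*f] k f 0) ⟩
  Δ (suc k) (λ x → (+ x) ^ suc n) 0
    ∎
  where
  open ≡-Reasoning
  f = λ x → (+ x) ^ n
  cancel : ∀ a b → (a - b) + b ≡ a
  cancel = solve-∀

k>n⇒stirling2≡0 : ∀ {n k} → n < k → stirling2 n k ≡ 0
k>n⇒stirling2≡0 {zero}  {suc k} _         = refl
k>n⇒stirling2≡0 {suc n} {suc k} (s≤s n<k) =
  cong₂ ℕ._+_ (trans (cong (suc k ℕ.*_) (k>n⇒stirling2≡0 (ℕ.m<n⇒m<1+n n<k))) (ℕ.*-zeroʳ (suc k)))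
              (k>n⇒stirling2≡0 n<k)

x^[p+n]≡x^[1+n] : ∀ {p} → Prime p → ∀ n x → (+ x) ^ (p ℕ.+ n) ≡ (+ x) ^ suc n mod + p
x^[p+n]≡x^[1+n] {p} p-prime n x = begin
  (+ x) ^ (p ℕ.+ n)     ≡⟨ ℤ.^-distribˡ-+-* (+ x) p n ⟩
  (+ x) ^ p * (+ x) ^ n ≈⟨ *-cong-mod (x^p≡x p-prime x) (≡-mod-refl {a = (+ x) ^ n}) ⟩
  + x * (+ x) ^ n       ∎
  where open SetoidReasoning (≡-mod-setoid (+ p))

stirling2*!-periodic : ∀ {p} → Prime p → ∀ n k →
  + (stirling2 (p ℕ.+ n) k ℕ.* k !) ≡ + (stirling2 (suc n) k ℕ.* k !) mod + p
stirling2*!-periodic {p} p-prime n k = begin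
  + (stirling2 (p ℕ.+ n) k ℕ.* k !)     ≡⟨ stirling2*!≡Δ (p ℕ.+ n) k ⟩
  Δ k (λ x → (+ x) ^ (p ℕ.+ n)) 0       ≈⟨ Δ-cong-mod k (x^[p+n]≡x^[1+n] p-prime n) 0 ⟩
  Δ k (λ x → (+ x) ^ suc n) 0           ≡⟨ stirling2*!≡Δ (suc n) k ⟨
  + (stirling2 (suc n) k ℕ.* k !)       ∎
  where open SetoidReasoning (≡-mod-setoid (+ p))

sumTo-cong-mod : ∀ {m} n {f g} → (∀ k → f k ≡ g k mod m) → sumTo n f ≡ sumTo n g mod m
sumTo-cong-mod zero    f≡g = f≡g 0
sumTo-cong-mod (suc n) f≡g = +-cong-mod (sumTo-cong-mod n f≡g) (f≡g (suc n))

sumTo-extend : ∀ {m n} f → (∀ k → m < k → f k ≡ 0ℤ) → m ≤′ n → sumTo n f ≡ sumTo m f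
sumTo-extend f vanish ≤′-refl            = refl
sumTo-extend f vanish (≤′-step m≤′n) =
  trans (cong₂ _+_ (sumTo-extend f vanish m≤′n) (vanish _ (s≤s (ℕ.≤′⇒≤ m≤′n)))) (ℤ.+-identityʳ _)

w-periodic : ∀ {p} → Prime p → ∀ n y → w (p ℕ.+ n) y ≡ w (suc n) y mod + p
w-periodic {suc r} p-prime n y = begin
  sumTo (suc r ℕ.+ n) (term (suc r ℕ.+ n)) ≈⟨ sumTo-cong-mod (suc r ℕ.+ n) coefficients-agree ⟩
  sumTo (suc r ℕ.+ n) (term (suc n))       ≡⟨ sumTo-extend (term (suc n)) vanish (ℕ.≤⇒≤′ (s≤s (ℕ.m≤n+m n r))) ⟩
  sumTo (suc n) (term (suc n))             ∎
  where
  open SetoidReasoning (≡-mod-setoid (+ suc r))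
  term : ℕ → ℕ → ℤ
  term m k = + (stirling2 m k ℕ.* k !) * y ^ k

  coefficients-agree : ∀ k → term (suc r ℕ.+ n) k ≡ term (suc n) k mod + suc r
  coefficients-agree k = *-cong-mod (stirling2*!-periodic p-prime n k) (≡-mod-refl {a = y ^ k})

  vanish : ∀ k → suc n < k → term (suc n) k ≡ 0ℤ
  vanish k n<k = cong (λ s → + (s ℕ.* k !) * y ^ k) (k>n⇒stirling2≡0 n<k)

lemma4p2 : (q : ℕ) → Prime q → (y : ℤ) → (n : ℕ) → n ≥ 1 →
    (+ q) ∣ (w ((q ℕ.+ n) ℕ.∸ 1) y - w n y)
lemma4p2 q q-prime y (suc n) _ =
  subst (λ m → + q ∣ w m y - w (suc n) y) (sym (ℕ.+-∸-assoc q (s≤s z≤n)))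
        (∣⇒∣ᵤ (≡-mod⇒∣ (w-periodic q-prime n y)))
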